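{- Let $S=\{n_1,n_2,\ldots,n_s\}$ be a set of integers with $2\le n_s<\cdots<n_2<n_1$, and let $\delta_{\mathcal D}(S)$ denote the minimum number of $\mathcal D$-edges of a mixed hypergraph that is a one-realization of $S$. Then $\delta_{\mathcal D}(S)\ge \frac{n_1(n_1-1)}{2}$ if $n_1-1\notin S$, and $\delta_{\mathcal D}(S)\ge \frac{n_1(n_1-1)}{2}-1$ if $n_1-1\in S$.
   Context: A mixed hypergraph is a triple $\mathcal H=(X,\mathcal C,\mathcal D)$ where $X$ is a finite set and $\mathcal C,\mathcal D$ are families of subsets of $X$, called $\mathcal C$-edges and $\mathcal D$-edges. A proper $k$-coloring of $\mathcal H$ is a map from $X$ to a set of $k$ colors such that every $\mathcal C$-edge contains two vertices of a common color and every $\mathcal D$-edge contains two vertices of distinct colors; it is strict if all $k$ colors are used. Colorings are identified with the partitions of $X$ into color classes. The feasible set $\mathcal F(\mathcal H)$ is the set of all $k$ such that $\mathcal H$ has a strict $k$-coloring; for $k\in\mathcal F(\mathcal H)$, $r_k$ is the number of partitions of $X$ arising as strict $k$-colorings. $\mathcal H$ is a one-realization of a set $S$ of positive integers if $\mathcal F(\mathcal H)=S$ and $r_k=1$ for every $k\in S$. -}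

module Defs where

open import Data.Nat using (ℕ)
open import Data.Fin using (Fin)
open import Data.Fin.Subset using (Subset; _∈_)
open import Data.List using (List)
open import Data.List.Relation.Unary.Unique.Propositional using (Unique)
import Data.List.Membership.Propositional as LM
open import Data.List.Relation.Unary.All using (All)
open import Data.Product using (Σ; ∃; ∃-syntax; _×_)
open import Function.Definitions using (Surjective)
open import Relation.Binary.PropositionalEquality using (_≡_; _≢_)
open import Relation.Nullary using (¬_)
open import Function.Bundles using (_⇔_)

-- A mixed hypergraph on the vertex set X = Fin n.
-- C-edges and D-edges are *families* (sets) of subsets, modelled as
-- duplicate-free lists of subsets of Fin n.
record MixedHypergraph (n : ℕ) : Set where
  field
    𝒞 : List (Subset n)
    𝒟 : List (Subset n)
    𝒞-unique : Unique 𝒞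
    𝒟-unique : Unique 𝒟
open MixedHypergraph public

CEdgeOk : ∀ {n k} → (Fin n → Fin k) → Subset n → Set
CEdgeOk c E = ∃[ x ] ∃[ y ] (x ∈ E × y ∈ E × x ≢ y × c x ≡ c y)

DEdgeOk : ∀ {n k} → (Fin n → Fin k) → Subset n → Set
DEdgeOk c E = ∃[ x ] ∃[ y ] (x ∈ E × y ∈ E × c x ≢ c y)

Proper : ∀ {n k} → MixedHypergraph n → (Fin n → Fin k) → Set
Proper H c = All (CEdgeOk c) (𝒞 H) × All (DEdgeOk c) (𝒟 H)

StrictColoring : ∀ {n} → MixedHypergraph n → (k : ℕ) → (Fin n → Fin k) → Set
StrictColoring {n} H k c = Proper H c × Surjective _≡_ _≡_ c

SamePartition : ∀ {n k l} → (Fin n → Fin k) → (Fin n → Fin l) → Set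
SamePartition c c' = ∀ x y → (c x ≡ c y) ⇔ (c' x ≡ c' y)

Feasible : ∀ {n} → MixedHypergraph n → ℕ → Set
Feasible H k = ∃[ c ] StrictColoring H k c

-- H is a one-realization of the set S (S given as a list of its elements):
-- 𝓕(H) = S and r_k = 1 for all k ∈ S (i.e. strict k-colorings exist and
-- all of them induce the same partition).
OneRealization : ∀ {n} → MixedHypergraph n → List ℕ → Set
OneRealization H S =
  (∀ k → (k LM.∈ S) ⇔ Feasible H k) ×
  (∀ k → k LM.∈ S → ∀ c c' → StrictColoring H k c → StrictColoring H k c' →
     SamePartition c c')

-- Fix a strict n₁-colouring c of H and, for each of the n₁(n₁-1)/2 pairs {i, j} of colours,
-- merge the classes i and j into one. The merged colouring keeps every C-edge and uses
-- n₁ - 1 colours, so it is strict unless some D-edge becomes monochromatic; then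
-- the two vertices of distinct c-colours chosen in that D-edge have colours {i, j}.
-- Different pairs thus charge different D-edges. If n₁ - 1 ∉ S every pair must be charged.
-- If n₁ - 1 ∈ S at most one pair can escape: two merged colourings that are both strict
-- induce the same partition (r_{n₁-1} = 1), which forces the two merged pairs to coincide.
module Submission where

open import Defs
open import Data.Nat using (ℕ; zero; suc; _+_; _≤_; _*_; _∸_; _/_; z≤n; s≤s)
open import Data.Nat.Properties using (≤-trans; m∸n≤m; <-asym)
open import Data.Nat.DivMod using (m*n/n≡m)
open import Data.Nat.Solver using (module +-*-Solver)
open import Data.Fin using (Fin; zero; suc; punchIn; punchOut; splitAt; join)
  renaming (_<_ to _<ᶠ_)
open import Data.Fin.Properties
  using (_≟_; any?; all?; ¬∀⟶∃¬; injective⇒≤; <-irrefl; suc-injective; join-splitAt;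
         punchIn-injective; punchInᵢ≢i; punchOut-cong; punchOut-injective; punchOut-punchIn)
import Data.Fin.Subset as Subset
open import Data.Fin.Subset.Properties using (_∈?_)
open import Data.List using (List; []; _∷_; length; lookup)
open import Data.List.Membership.Propositional using (_∈_; _∉_)
open import Data.List.Relation.Unary.All as All using (All; []; _∷_)
open import Data.List.Relation.Unary.Any as Any using (Any; here; there)
open import Data.List.Relation.Unary.Any.Properties using (lookup-index)
open import Data.Product using (_×_; _,_; proj₁; proj₂)
open import Data.Sum using (_⊎_; inj₁; inj₂)
open import Data.Empty using (⊥-elim)
open import Function using (_∘_)
open import Function.Bundles using (module Equivalence)
open import Function.Definitions using (Surjective)
open import Relation.Nullary using (¬_; Dec; yes; no)
open import Relation.Nullary.Decidable using (_×-dec_; ¬?; decidable-stable)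
open import Relation.Unary using (Decidable)
open import Relation.Binary.PropositionalEquality
  using (_≡_; _≢_; refl; sym; trans; cong; cong₂; subst; module ≡-Reasoning)

triangle : ℕ → ℕ
triangle zero    = 0
triangle (suc n) = n + triangle n

triangle-double : ∀ n → n * (n ∸ 1) ≡ triangle n * 2
triangle-double zero          = refl
triangle-double (suc zero)    = refl
triangle-double (suc (suc n)) = begin
  (2 + n) * (1 + n)                      ≡⟨ expand n ⟩
  (1 + n) + ((1 + n) + (1 + n) * n)      ≡⟨ cong (λ z → (1 + n) + ((1 + n) + z)) (triangle-double (suc n)) ⟩
  (1 + n) + ((1 + n) + triangle (suc n) * 2) ≡⟨ collect (suc n) (triangle (suc n)) ⟩
  triangle (suc (suc n)) * 2             ∎
  where
  open ≡-Reasoning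
  open +-*-Solver
  expand : ∀ n → (2 + n) * (1 + n) ≡ (1 + n) + ((1 + n) + (1 + n) * n)
  expand = solve 1 (λ n → (con 2 :+ n) :* (con 1 :+ n) := (con 1 :+ n) :+ ((con 1 :+ n) :+ (con 1 :+ n) :* n)) refl
  collect : ∀ a t → a + (a + t * 2) ≡ (a + t) * 2
  collect = solve 2 (λ a t → a :+ (a :+ t :* con 2) := (a :+ t) :* con 2) refl

n*[n∸1]/2≡triangle : ∀ n → n * (n ∸ 1) / 2 ≡ triangle n
n*[n∸1]/2≡triangle n = trans (cong (_/ 2) (triangle-double n)) (m*n/n≡m (triangle n) 2)

-- An increasing pair stands for a 2-element set of colours; SameEnds compares pairs as sets.
Pair : ℕ → Set
Pair m = Fin m × Fin m

Increasing : ∀ {m} → Pair m → Set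
Increasing (i , j) = i <ᶠ j

increasing⇒≢ : ∀ {m} {p : Pair m} → Increasing p → proj₁ p ≢ proj₂ p
increasing⇒≢ i<j i≡j = <-irrefl i≡j i<j

SameEnds : ∀ {m} → Pair m → Pair m → Set
SameEnds (i , j) (x , y) = (x ≡ i × y ≡ j) ⊎ (x ≡ j × y ≡ i)

sameEnds? : ∀ {m} (p r : Pair m) → Dec (SameEnds p r)
sameEnds? (i , j) (x , y) with (x ≟ i) ×-dec (y ≟ j) | (x ≟ j) ×-dec (y ≟ i)
... | yes same | _       = yes (inj₁ same)
... | no _     | yes swp = yes (inj₂ swp)
... | no ¬same | no ¬swp = no λ { (inj₁ same) → ¬same same ; (inj₂ swp) → ¬swp swp }

sameEnds-increasing-unique : ∀ {m} {p q r : Pair m} → Increasing p → Increasing q →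
                             SameEnds p r → SameEnds q r → p ≡ q
sameEnds-increasing-unique _   _   (inj₁ (refl , refl)) (inj₁ (refl , refl)) = refl
sameEnds-increasing-unique _   _   (inj₂ (refl , refl)) (inj₂ (refl , refl)) = refl
sameEnds-increasing-unique p<  q<  (inj₁ (refl , refl)) (inj₂ (refl , refl)) = ⊥-elim (<-asym p< q<)
sameEnds-increasing-unique p<  q<  (inj₂ (refl , refl)) (inj₁ (refl , refl)) = ⊥-elim (<-asym p< q<)

splitAt-injective : ∀ m {n} {s t : Fin (m + n)} → splitAt m s ≡ splitAt m t → s ≡ t
splitAt-injective m {n} {s} {t} e = begin
  s                      ≡⟨ join-splitAt m n s ⟨
  join m n (splitAt m s) ≡⟨ cong (join m n) e ⟩
  join m n (splitAt m t) ≡⟨ join-splitAt m n t ⟩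
  t                      ∎
  where open ≡-Reasoning

increasingPair : ∀ m → Fin (triangle m) → Pair m
increasingPair⁺ : ∀ m → Fin m ⊎ Fin (triangle m) → Pair (suc m)
increasingPair (suc m) = increasingPair⁺ m ∘ splitAt m
increasingPair⁺ m (inj₁ j) = zero , suc j
increasingPair⁺ m (inj₂ u) = suc (proj₁ (increasingPair m u)) , suc (proj₂ (increasingPair m u))

increasingPair-increasing : ∀ m t → Increasing (increasingPair m t)
increasingPair⁺-increasing : ∀ m t → Increasing (increasingPair⁺ m t)
increasingPair-increasing (suc m) t = increasingPair⁺-increasing m (splitAt m t)
increasingPair⁺-increasing m (inj₁ j) = s≤s z≤n
increasingPair⁺-increasing m (inj₂ u) = s≤s (increasingPair-increasing m u)

increasingPair-injective : ∀ m {s t} → increasingPair m s ≡ increasingPair m t → s ≡ t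
increasingPair⁺-injective : ∀ m {s t} → increasingPair⁺ m s ≡ increasingPair⁺ m t → s ≡ t
increasingPair-injective (suc m) = splitAt-injective m ∘ increasingPair⁺-injective m
increasingPair⁺-injective m {inj₁ _} {inj₁ _} e = cong inj₁ (suc-injective (cong proj₂ e))
increasingPair⁺-injective m {inj₂ _} {inj₂ _} e = cong inj₂ (increasingPair-injective m
  (cong₂ _,_ (suc-injective (cong proj₁ e)) (suc-injective (cong proj₂ e))))

IndexInjective : ∀ {N L} (P : Fin N → Set) → (∀ {t} → P t → Fin L) → Set
IndexInjective P index = ∀ {s t} (p : P s) (q : P t) → index p ≡ index q → s ≡ t

all⇒≤ : ∀ {N L} {P : Fin N → Set} (index : ∀ {t} → P t → Fin L) →
        IndexInjective P index → (∀ t → P t) → N ≤ L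
all⇒≤ index index-injective all = injective⇒≤ (index-injective (all _) (all _))

allButOne⇒∸1≤ : ∀ {N L} {P : Fin N → Set} (index : ∀ {t} → P t → Fin L) →
                IndexInjective P index → Decidable P → (∀ {s t} → ¬ P s → ¬ P t → s ≡ t) → N ∸ 1 ≤ L
allButOne⇒∸1≤ {N} index index-injective P? ¬P-unique with all? P?
... | yes all = ≤-trans (m∸n≤m N 1) (all⇒≤ index index-injective all)
... | no ¬all with ¬∀⟶∃¬ N _ P? ¬all
allButOne⇒∸1≤ {suc N} {P = P} index index-injective P? ¬P-unique | no _ | t₀ , ¬Pt₀ =
  injective⇒≤ λ e → punchIn-injective t₀ _ _ (index-injective (P-punchIn _) (P-punchIn _) e)
  where
  P-punchIn : ∀ u → P (punchIn t₀ u)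
  P-punchIn u with P? (punchIn t₀ u)
  ... | yes p = p
  ... | no ¬p = ⊥-elim (punchInᵢ≢i t₀ u (¬P-unique ¬p ¬Pt₀))

-- j is removed and its class goes to i.
module Merge {m : ℕ} (i j : Fin (suc m)) (i≢j : i ≢ j) where

  merge : Fin (suc m) → Fin m
  merge x with x ≟ j
  ... | yes _   = punchOut {i = j} {j = i} (i≢j ∘ sym)
  ... | no x≢j = punchOut {i = j} {j = x} (x≢j ∘ sym)

  merge-i≡merge-j : merge i ≡ merge j
  merge-i≡merge-j with i ≟ j | j ≟ j
  ... | yes i≡j | _       = ⊥-elim (i≢j i≡j)
  ... | no _    | no j≢j = ⊥-elim (j≢j refl)
  ... | no _    | yes _   = punchOut-cong j refl

  merge-reflects : ∀ x y → merge x ≡ merge y → x ≡ y ⊎ SameEnds (i , j) (x , y)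
  merge-reflects x y e with x ≟ j | y ≟ j
  ... | yes x≡j | yes y≡j = inj₁ (trans x≡j (sym y≡j))
  ... | yes x≡j | no y≢j = inj₂ (inj₂ (x≡j , sym (punchOut-injective (i≢j ∘ sym) (y≢j ∘ sym) e)))
  ... | no x≢j | yes y≡j = inj₂ (inj₁ (punchOut-injective (x≢j ∘ sym) (i≢j ∘ sym) e , y≡j))
  ... | no x≢j | no y≢j = inj₁ (punchOut-injective (x≢j ∘ sym) (y≢j ∘ sym) e)

  merge-punchIn : ∀ y → merge (punchIn j y) ≡ y
  merge-punchIn y with punchIn j y ≟ j
  ... | yes e = ⊥-elim (punchInᵢ≢i j y e)
  ... | no _  = trans (punchOut-cong j refl) (punchOut-punchIn j)

  merge-surjective : Surjective _≡_ _≡_ merge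
  merge-surjective y = punchIn j y , λ { refl → merge-punchIn y }

dEdgeOk-or-monochromatic : ∀ {n k} (c : Fin n → Fin k) E →
                           DEdgeOk c E ⊎ (∀ {x y} → x Subset.∈ E → y Subset.∈ E → c x ≡ c y)
dEdgeOk-or-monochromatic c E
  with any? (λ x → any? (λ y → (x ∈? E) ×-dec (y ∈? E) ×-dec ¬? (c x ≟ c y)))
... | yes ok = inj₁ ok
... | no ¬ok = inj₂ monochromatic
  where
  monochromatic : ∀ {x y} → x Subset.∈ E → y Subset.∈ E → c x ≡ c y
  monochromatic {x} {y} x∈E y∈E with c x ≟ c y
  ... | yes cx≡cy = cx≡cy
  ... | no cx≢cy = ⊥-elim (¬ok (x , y , x∈E , y∈E , cx≢cy))

witnessColours : ∀ {n k} (c : Fin n → Fin k) {D} → All (DEdgeOk c) D → List (Pair k)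
witnessColours c []                    = []
witnessColours c ((x , y , _) ∷ oks) = (c x , c y) ∷ witnessColours c oks

length-witnessColours : ∀ {n k} (c : Fin n → Fin k) {D} (oks : All (DEdgeOk c) D) →
                        length (witnessColours c oks) ≡ length D
length-witnessColours c []        = refl
length-witnessColours c (_ ∷ oks) = cong suc (length-witnessColours c oks)

module _ {n m : ℕ} (c : Fin n → Fin (suc m)) {i j : Fin (suc m)} (i≢j : i ≢ j) where
  open Merge i j i≢j

  merged-dEdgeOk-or-witnessed : ∀ {D} (oks : All (DEdgeOk c) D) →
    All (DEdgeOk (merge ∘ c)) D ⊎ Any (SameEnds (i , j)) (witnessColours c oks)
  merged-dEdgeOk-or-witnessed [] = inj₁ []
  merged-dEdgeOk-or-witnessed {E ∷ _} ((x , y , x∈E , y∈E , cx≢cy) ∷ oks)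
    with dEdgeOk-or-monochromatic (merge ∘ c) E
  ... | inj₂ monochromatic with merge-reflects (c x) (c y) (monochromatic x∈E y∈E)
  ...   | inj₁ cx≡cy  = ⊥-elim (cx≢cy cx≡cy)
  ...   | inj₂ same = inj₂ (here same)
  merged-dEdgeOk-or-witnessed (_ ∷ oks) | inj₁ ok with merged-dEdgeOk-or-witnessed oks
  ... | inj₁ oks′    = inj₁ (ok ∷ oks′)
  ... | inj₂ witness = inj₂ (there witness)

  merged-strict : ∀ (H : MixedHypergraph n) → StrictColoring H (suc m) c →
                  All (DEdgeOk (merge ∘ c)) (𝒟 H) → StrictColoring H m (merge ∘ c)
  merged-strict H ((cOks , _) , c-surjective) dOks = (All.map cEdgeOk cOks , dOks) , surjective
    where
    cEdgeOk : ∀ {E} → CEdgeOk c E → CEdgeOk (merge ∘ c) E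
    cEdgeOk (x , y , x∈E , y∈E , x≢y , cx≡cy) = x , y , x∈E , y∈E , x≢y , cong merge cx≡cy
    surjective : Surjective _≡_ _≡_ (merge ∘ c)
    surjective y with merge-surjective y
    ... | z , merge-z with c-surjective z
    ...   | x , c-x = x , λ z≡x → merge-z (c-x z≡x)

samePartition-merged⇒sameEnds :
  ∀ {n m} {c : Fin n → Fin (suc m)} → Surjective _≡_ _≡_ c →
  ∀ {i j i′ j′} (i≢j : i ≢ j) (i′≢j′ : i′ ≢ j′) →
  SamePartition (Merge.merge i j i≢j ∘ c) (Merge.merge i′ j′ i′≢j′ ∘ c) → SameEnds (i′ , j′) (i , j)
samePartition-merged⇒sameEnds {c = c} c-surjective {i} {j} i≢j i′≢j′ same
  with c-surjective i | c-surjective j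
... | x , c-x | y , c-y
  with Merge.merge-reflects _ _ i′≢j′ (c x) (c y) (Equivalence.to (same x y) merged-x≡merged-y)
  where
  merged-x≡merged-y : Merge.merge i j i≢j (c x) ≡ Merge.merge i j i≢j (c y)
  merged-x≡merged-y rewrite c-x refl | c-y refl = Merge.merge-i≡merge-j i j i≢j
... | inj₁ cx≡cy = ⊥-elim (i≢j (trans (sym (c-x refl)) (trans cx≡cy (c-y refl))))
... | inj₂ same′ rewrite c-x refl | c-y refl = same′

module PairMerging {n m : ℕ} (H : MixedHypergraph n) (c : Fin n → Fin (suc m))
                   (c-strict : StrictColoring H (suc m) c) where

  pair : Fin (triangle (suc m)) → Pair (suc m)
  pair = increasingPair (suc m)

  pair-distinct : ∀ t → proj₁ (pair t) ≢ proj₂ (pair t)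
  pair-distinct t = increasing⇒≢ (increasingPair-increasing (suc m) t)

  merged : Fin (triangle (suc m)) → Fin n → Fin m
  merged t = Merge.merge (proj₁ (pair t)) (proj₂ (pair t)) (pair-distinct t) ∘ c

  witnesses : List (Pair (suc m))
  witnesses = witnessColours c (proj₂ (proj₁ c-strict))

  length-witnesses : length witnesses ≡ length (𝒟 H)
  length-witnesses = length-witnessColours c (proj₂ (proj₁ c-strict))

  Charged : Fin (triangle (suc m)) → Set
  Charged t = Any (SameEnds (pair t)) witnesses

  charged? : Decidable Charged
  charged? t = Any.any? (sameEnds? (pair t)) witnesses

  charged-index-injective : IndexInjective Charged Any.index
  charged-index-injective {s} {t} p q e = increasingPair-injective (suc m)
    (sameEnds-increasing-unique (increasingPair-increasing (suc m) s) (increasingPair-increasing (suc m) t)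
      (lookup-index p) (subst (SameEnds (pair t) ∘ lookup witnesses) (sym e) (lookup-index q)))

  uncharged⇒merged-strict : ∀ {t} → ¬ Charged t → StrictColoring H m (merged t)
  uncharged⇒merged-strict {t} ¬charged
    with merged-dEdgeOk-or-witnessed c (pair-distinct t) (proj₂ (proj₁ c-strict))
  ... | inj₁ dOks   = merged-strict c (pair-distinct t) H c-strict dOks
  ... | inj₂ charged = ⊥-elim (¬charged charged)

  samePartition-merged⇒≡ : ∀ {s t} → SamePartition (merged s) (merged t) → s ≡ t
  samePartition-merged⇒≡ {s} {t} same = increasingPair-injective (suc m)
    (sameEnds-increasing-unique (increasingPair-increasing (suc m) s) (increasingPair-increasing (suc m) t)
      (inj₁ (refl , refl)) (samePartition-merged⇒sameEnds (proj₂ c-strict) (pair-distinct s) (pair-distinct t) same))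

lemma2p1 : (S : List ℕ) (n₁ : ℕ) →
    n₁ ∈ S → (∀ m → m ∈ S → 2 ≤ m × m ≤ n₁) →
    (∀ {n} (H : MixedHypergraph n) → OneRealization H S →
      (n₁ ∸ 1 ∉ S → (n₁ * (n₁ ∸ 1)) / 2 ≤ length (𝒟 H)) ×
      (n₁ ∸ 1 ∈ S → (n₁ * (n₁ ∸ 1)) / 2 ∸ 1 ≤ length (𝒟 H)))
lemma2p1 S zero 0∈S bounds H _ with () ← proj₁ (bounds 0 0∈S)
lemma2p1 S (suc m) n₁∈S _ H (feasible , samePartition)
  with Equivalence.to (feasible (suc m)) n₁∈S
... | c , c-strict = all-charged , all-but-one-charged
  where
  open PairMerging H c c-strict

  all-charged : m ∉ S → suc m * m / 2 ≤ length (𝒟 H)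
  all-charged m∉S rewrite n*[n∸1]/2≡triangle (suc m) | sym length-witnesses =
    all⇒≤ Any.index charged-index-injective λ t → decidable-stable (charged? t) λ ¬charged →
      m∉S (Equivalence.from (feasible m) (merged t , uncharged⇒merged-strict ¬charged))

  all-but-one-charged : m ∈ S → suc m * m / 2 ∸ 1 ≤ length (𝒟 H)
  all-but-one-charged m∈S rewrite n*[n∸1]/2≡triangle (suc m) | sym length-witnesses =
    allButOne⇒∸1≤ Any.index charged-index-injective charged? λ ¬charged-s ¬charged-t →
      samePartition-merged⇒≡ (samePartition m m∈S _ _
        (uncharged⇒merged-strict ¬charged-s) (uncharged⇒merged-strict ¬charged-t))
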